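{- For every $m$, with $v_1,\dots,v_{m+2}$ a basis of a vector space $\mathcal V$, the polynomial $\mathcal P_m$ satisfies $$\mathcal P_m(v_2+v_3,v_4,v_5,\dots,v_{m+2})+\mathcal P_m(v_3+v_4,v_2,v_5,\dots,v_{m+2})+\mathcal P_m(v_2+v_4,v_3,v_5,\dots,v_{m+2})=0.$$
   Context: Let $y_{ijk}$ ($i,j,k\in\{1,\dots,m\}$) be indeterminates, totally antisymmetric in their indices ($y_{ijk}=-y_{jik}=y_{jki}$, $y_{iij}=0$). Let $\Lambda=(\lambda_{ij})_{1\le i,j\le m}$ with $\lambda_{ij}=\sum_k y_{ijk}$. The Pfaffian-tree polynomial is $\mathcal P_m=(-1)^{p-1}\operatorname{Pf}(\Lambda^{(p)})$, where $\Lambda^{(p)}$ is $\Lambda$ with the $p$th row and column removed (independent of $p$; Pfaffian of an odd-size matrix is $0$). Identifying $y_{ijk}$ with $u_i\wedge u_j\wedge u_k$ for a basis $u_1,\dots,u_m$, $\mathcal P_m$ is an element of $S^{(m-1)/2}(\Lambda^3)$, and for vectors $w_1,\dots,w_m$ in a vector space $\mathcal V$, $\mathcal P_m(w_1,\dots,w_m)\in S(\Lambda^3\mathcal V)$ denotes the result of substituting $w_i\wedge w_j\wedge w_k$ for each $y_{ijk}$ in $\mathcal P_m$. -}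

module Defs where

open import Algebra.Bundles using (CommutativeRing)
open import Data.Nat using (ℕ; zero; suc; _∸_; _≡ᵇ_) renaming (_+_ to _+ℕ_)
open import Data.Fin using (Fin; zero; suc; toℕ; punchIn)
open import Data.Bool using (if_then_else_)
open import Function using (_∘_)
open import Data.Product using (_×_)
import Level

module _ {c ℓ} (R : CommutativeRing c ℓ) where
  open CommutativeRing R using (Carrier; _≈_; _+_; _*_; -_; 0#; 1#)

  Σ : (k : ℕ) → (Fin k → Carrier) → Carrier
  Σ zero    f = 0#
  Σ (suc k) f = f zero + Σ k (f ∘ suc)

  sgn : ℕ → Carrier
  sgn zero    = 1#
  sgn (suc k) = - sgn k

  Pf : (n : ℕ) → (Fin n → Fin n → Carrier) → Carrier
  Pf zero          A = 1#
  Pf (suc zero)    A = 0#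
  Pf (suc (suc n)) A =
    Σ (suc n) λ j → sgn (toℕ j) * A zero (suc j)
                     * Pf n (λ a b → A (suc (punchIn j a)) (suc (punchIn j b)))

  Λmat : (m : ℕ) → (Fin m → Fin m → Fin m → Carrier) → Fin m → Fin m → Carrier
  Λmat m y i j = Σ m (λ k → y i j k)

  -- Pfaffian-tree polynomial P_m (m = suc n) evaluated at values y_{ijk}:
  -- (-1)^{p-1} Pf(Λ^{(p)}) with p = 1 (first row/column removed).
  PfTree : (n : ℕ) → (Fin (suc n) → Fin (suc n) → Fin (suc n) → Carrier) → Carrier
  PfTree n y = Pf n (λ i j → Λmat (suc n) y (suc i) (suc j))

  -- vectors of V = R^D in coordinates w.r.t. the basis v_1..v_D
  Vect : ℕ → Set c
  Vect D = Fin D → Carrier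

  _⊕_ : ∀ {D} → Vect D → Vect D → Vect D
  (x ⊕ y) b = x b + y b

  -- basis vector v_i, 1-based index i (so v 1 is the first basis vector)
  v : ∀ {D} → ℕ → Vect D
  v i b = if toℕ b ≡ᵇ (i ∸ 1) then 1# else 0#

  -- An alternating trilinear form on V, given by its values t a b c
  -- on basis vectors (i.e. a linear functional on Λ³V).
  IsAlternating : ∀ {D} → (Fin D → Fin D → Fin D → Carrier) → Set ℓ
  IsAlternating t =
      (∀ a b d → t a b d ≈ - t b a d)
    × (∀ a b d → t a b d ≈ t b d a)
    × (∀ a d → t a a d ≈ 0#)

  wedge3 : ∀ {D} → (Fin D → Fin D → Fin D → Carrier) → Vect D → Vect D → Vect D → Carrier
  wedge3 {D} t w1 w2 w3 =
    Σ D λ a → Σ D λ b → Σ D λ d → w1 a * w2 b * w3 d * t a b d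

  evalP : ∀ {D} (n : ℕ) → (Fin D → Fin D → Fin D → Carrier) → (Fin (suc n) → Vect D) → Carrier
  evalP n t w = PfTree n (λ i j k → wedge3 t (w i) (w j) (w k))

  fam : ∀ {D} (n : ℕ) → Vect D → Vect D → Fin (suc (suc n)) → Vect D
  fam n x y zero          = x
  fam n x y (suc zero)    = y
  fam n x y (suc (suc k)) = v (toℕ k +ℕ 5)

-- On basis vectors every entry of the three matrices is a sum of values of the alternating
-- form t.  Expanding each Pfaffian along its first row (the row of the second family member),
-- the three matrices share the remaining block M_ab = Σ_z t(a, b, z), z running over
-- v₂, v₃, v₄, v₅, …, and differ only in that first row.  Antisymmetry of t makes the three
-- first rows add up to minus the column sums of M, so by linearity in the first row the sum
-- of the three Pfaffians is minus Σᵢ Pf(M bordered by its own row i), and each of these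
-- Pfaffians has two equal rows.  That a Pfaffian with two equal rows vanishes follows from
-- its change of sign under adjacent transpositions, which is proved by expanding twice.

module Submission where

open import Defs
open import Algebra.Bundles using (CommutativeRing)
open import Data.Nat using (ℕ; suc) renaming (_+_ to _+ℕ_)
open import Data.Fin using (Fin)

open import Data.Nat using (zero; _<_; s≤s; z≤n)
import Data.Nat.Properties as ℕ
open import Data.Fin using (zero; suc; toℕ; punchIn; inject₁; fromℕ<)
open import Data.Fin.Properties using (toℕ-fromℕ<; toℕ<n)
open import Data.Fin.Induction using (<-weakInduction)
open import Data.Fin.Permutation using (permutation)
open import Data.Vec.Functional using (_∷_)
open import Data.Product using (_×_; _,_; proj₁; proj₂)
open import Function using (_∘_)
open import Level using (_⊔_)
open import Relation.Binary.PropositionalEquality as ≡ using (_≡_; _≗_)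

module _ {c ℓ} (R : CommutativeRing c ℓ) where
  open CommutativeRing R hiding (zero)
  open import Algebra.Properties.Ring ring
    using (-‿distribˡ-*; -‿distribʳ-*; -‿involutive; -‿+-comm; -0#≈0#; +-inverseˡ-unique)
  open import Algebra.Properties.Semiring.Sum semiring
    using (sum; sum-cong-≋; sum-replicate-zero; ∑-distrib-+; ∑-comm; ∑-permute; *-distribˡ-sum)
  open import Algebra.Solver.Ring.NaturalCoefficients.Default commutativeSemiring
  open import Relation.Binary.Reasoning.Setoid setoid

  -- Finite sums

  Σ≡sum : ∀ k (f : Fin k → Carrier) → Σ R k f ≡ sum f
  Σ≡sum zero    f = ≡.refl
  Σ≡sum (suc k) f = ≡.cong (f zero +_) (Σ≡sum k (f ∘ suc))

  Σ-cong : ∀ k {f g : Fin k → Carrier} → (∀ i → f i ≈ g i) → Σ R k f ≈ Σ R k g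
  Σ-cong k {f} {g} f≈g = begin
    Σ R k f ≡⟨ Σ≡sum k f ⟩
    sum f   ≈⟨ sum-cong-≋ f≈g ⟩
    sum g   ≡⟨ Σ≡sum k g ⟨
    Σ R k g ∎

  Σ-zero : ∀ k {f : Fin k → Carrier} → (∀ i → f i ≈ 0#) → Σ R k f ≈ 0#
  Σ-zero k f≈0 = trans (Σ-cong k f≈0) (≡.subst (_≈ 0#) (≡.sym (Σ≡sum k _)) (sum-replicate-zero k))

  Σ-distrib-+ : ∀ k (f g : Fin k → Carrier) → Σ R k (λ i → f i + g i) ≈ Σ R k f + Σ R k g
  Σ-distrib-+ k f g = begin
    Σ R k (λ i → f i + g i) ≡⟨ Σ≡sum k _ ⟩
    sum (λ i → f i + g i)   ≈⟨ ∑-distrib-+ f g ⟩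
    sum f + sum g           ≡⟨ ≡.cong₂ _+_ (Σ≡sum k f) (Σ≡sum k g) ⟨
    Σ R k f + Σ R k g       ∎

  *-distribˡ-Σ : ∀ k x (f : Fin k → Carrier) → x * Σ R k f ≈ Σ R k (λ i → x * f i)
  *-distribˡ-Σ k x f = begin
    x * Σ R k f             ≡⟨ ≡.cong (x *_) (Σ≡sum k f) ⟩
    x * sum f               ≈⟨ *-distribˡ-sum x f ⟩
    sum (λ i → x * f i)     ≡⟨ Σ≡sum k _ ⟨
    Σ R k (λ i → x * f i)   ∎

  *-distribʳ-Σ : ∀ k x (f : Fin k → Carrier) → Σ R k f * x ≈ Σ R k (λ i → f i * x)
  *-distribʳ-Σ k x f = trans (*-comm _ x) (trans (*-distribˡ-Σ k x f) (Σ-cong k (λ i → *-comm x (f i))))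

  -‿distrib-Σ : ∀ k (f : Fin k → Carrier) → - Σ R k f ≈ Σ R k (λ i → - f i)
  -‿distrib-Σ zero    f = -0#≈0#
  -‿distrib-Σ (suc k) f = trans (sym (-‿+-comm _ _)) (+-congˡ (-‿distrib-Σ k (f ∘ suc)))

  Σ-comm : ∀ k l (f : Fin k → Fin l → Carrier) →
           Σ R k (λ i → Σ R l (f i)) ≈ Σ R l (λ j → Σ R k (λ i → f i j))
  Σ-comm k l f = begin
    Σ R k (λ i → Σ R l (f i))         ≈⟨ Σ-cong k (λ i → reflexive (Σ≡sum l (f i))) ⟩
    Σ R k (λ i → sum (f i))           ≡⟨ Σ≡sum k _ ⟩
    sum (λ i → sum (f i))             ≈⟨ ∑-comm f ⟩
    sum (λ j → sum (λ i → f i j))     ≡⟨ Σ≡sum l _ ⟨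
    Σ R l (λ j → sum (λ i → f i j))   ≈⟨ Σ-cong l (λ j → reflexive (≡.sym (Σ≡sum k _))) ⟩
    Σ R l (λ j → Σ R k (λ i → f i j)) ∎

  Σ-skew : ∀ k (f : Fin k → Fin k → Carrier) → (∀ i j → f i j ≈ - f j i) → (∀ i → f i i ≈ 0#) →
           Σ R k (λ i → Σ R k (f i)) ≈ 0#
  Σ-skew zero    f skew hollow = refl
  Σ-skew (suc k) f skew hollow = begin
    (f zero zero + Σ R k (f zero ∘ suc)) + Σ R k (λ i → f (suc i) zero + Σ R k (f (suc i) ∘ suc))
      ≈⟨ +-cong (+-congʳ (hollow zero)) (Σ-distrib-+ k _ _) ⟩
    (0# + Σ R k (f zero ∘ suc)) + (Σ R k (λ i → f (suc i) zero) + Σ R k (λ i → Σ R k (f (suc i) ∘ suc)))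
      ≈⟨ +-congˡ (+-congˡ (Σ-skew k _ (λ i j → skew (suc i) (suc j)) (hollow ∘ suc))) ⟩
    (0# + Σ R k (f zero ∘ suc)) + (Σ R k (λ i → f (suc i) zero) + 0#)
      ≈⟨ solve 2 (λ a b → (con 0 :+ a) :+ (b :+ con 0) := a :+ b) refl _ _ ⟩
    Σ R k (f zero ∘ suc) + Σ R k (λ i → f (suc i) zero)
      ≈⟨ Σ-distrib-+ k _ _ ⟨
    Σ R k (λ i → f zero (suc i) + f (suc i) zero)
      ≈⟨ Σ-zero k (λ i → trans (+-congˡ (skew (suc i) zero)) (-‿inverseʳ _)) ⟩
    0# ∎

  -- Pfaffians

  Matrix : ℕ → Set c
  Matrix n = Fin n → Fin n → Carrier

  Skew : ∀ {n} → Matrix n → Set ℓ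
  Skew A = ∀ a b → A a b ≈ - A b a

  Hollow : ∀ {n} → Matrix n → Set ℓ
  Hollow A = ∀ a → A a a ≈ 0#

  reindex : ∀ {m n} → (Fin m → Fin n) → Matrix n → Matrix m
  reindex f A a b = A (f a) (f b)

  lower : ∀ {n} → Matrix (suc n) → Matrix n
  lower = reindex suc

  minor : ∀ {n} → Fin (suc n) → Matrix (suc n) → Matrix n
  minor j = reindex (punchIn j)

  bordered : ∀ {n} → (Fin n → Carrier) → Matrix n → Matrix (suc n)
  bordered r M zero    zero    = 0#
  bordered r M zero    (suc b) = r b
  bordered r M (suc a) zero    = - r a
  bordered r M (suc a) (suc b) = M a b

  sign : ∀ {n} → Fin n → Carrier
  sign j = sgn R (toℕ j)

  Pf-cong : ∀ n {A B : Matrix n} → (∀ a b → A a b ≈ B a b) → Pf R n A ≈ Pf R n B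
  Pf-cong zero          A≈B = refl
  Pf-cong (suc zero)    A≈B = refl
  Pf-cong (suc (suc n)) A≈B = Σ-cong (suc n) λ j →
    *-cong (*-congˡ {sign j} (A≈B zero (suc j))) (Pf-cong n λ a b → A≈B (suc (punchIn j a)) (suc (punchIn j b)))

  Pf₂ : ∀ (A : Matrix 2) → Pf R 2 A ≈ A zero (suc zero)
  Pf₂ A = trans (+-identityʳ _) (trans (*-identityʳ _) (*-identityˡ _))

  Pf₃ : ∀ (A : Matrix 3) → Pf R 3 A ≈ 0#
  Pf₃ A = Σ-zero 2 λ j → zeroʳ (sign j * A zero (suc j))

  -- (a , l) stands for the ordered pair of distinct indices (a , punchIn a l);
  -- pairSwap exchanges the two entries of that pair.
  pairSwap : ∀ {k} → Fin (suc k) × Fin k → Fin (suc k) × Fin k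
  pairSwap {suc k} (zero  , l)     = suc l , zero
  pairSwap {suc k} (suc a , zero)  = zero , a
  pairSwap {suc k} (suc a , suc l) = suc (proj₁ q) , suc (proj₂ q)
    where q = pairSwap (a , l)

  pairSwap-fst : ∀ {k} (a : Fin (suc k)) l → proj₁ (pairSwap (a , l)) ≡ punchIn a l
  pairSwap-fst {suc k} zero    l       = ≡.refl
  pairSwap-fst {suc k} (suc a) zero    = ≡.refl
  pairSwap-fst {suc k} (suc a) (suc l) = ≡.cong suc (pairSwap-fst a l)

  punchIn-pairSwap : ∀ {k} (a : Fin (suc k)) l → let (b , m) = pairSwap (a , l) in punchIn b m ≡ a
  punchIn-pairSwap {suc k} zero    l       = ≡.refl
  punchIn-pairSwap {suc k} (suc a) zero    = ≡.refl
  punchIn-pairSwap {suc k} (suc a) (suc l) = ≡.cong suc (punchIn-pairSwap a l)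

  punchIn²-pairSwap : ∀ {k} (a : Fin (suc (suc k))) l x →
    let (b , m) = pairSwap (a , l) in punchIn b (punchIn m x) ≡ punchIn a (punchIn l x)
  punchIn²-pairSwap zero    l       x       = ≡.refl
  punchIn²-pairSwap (suc a) zero    x       = ≡.refl
  punchIn²-pairSwap {suc k} (suc a) (suc l) zero    = ≡.refl
  punchIn²-pairSwap {suc k} (suc a) (suc l) (suc x) = ≡.cong suc (punchIn²-pairSwap a l x)

  pairSwap-involutive : ∀ {k} (p : Fin (suc k) × Fin k) → pairSwap (pairSwap p) ≡ p
  pairSwap-involutive {suc k} (zero  , l)     = ≡.refl
  pairSwap-involutive {suc k} (suc a , zero)  = ≡.refl
  pairSwap-involutive {suc k} (suc a , suc l) = ≡.cong (λ (b , m) → suc b , suc m) (pairSwap-involutive (a , l))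

  pairSum : ∀ k → (Fin (suc k) × Fin k → Carrier) → Carrier
  pairSum k H = Σ R (suc k) λ a → Σ R k λ l → sign a * sign l * H (a , l)

  pairSum-+ : ∀ k (H H′ : Fin (suc k) × Fin k → Carrier) →
              pairSum k H + pairSum k H′ ≈ pairSum k (λ p → H p + H′ p)
  pairSum-+ k H H′ = begin
    Σ R (suc k) (row H) + Σ R (suc k) (row H′)
      ≈⟨ Σ-distrib-+ (suc k) (row H) (row H′) ⟨
    Σ R (suc k) (λ a → row H a + row H′ a)
      ≈⟨ Σ-cong (suc k) (λ a → Σ-distrib-+ k (term H a) (term H′ a)) ⟨
    Σ R (suc k) (λ a → Σ R k (λ l → term H a l + term H′ a l))
      ≈⟨ Σ-cong (suc k) (λ a → Σ-cong k (λ l → distribˡ (sign a * sign l) (H (a , l)) (H′ (a , l)))) ⟨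
    pairSum k (λ p → H p + H′ p) ∎
    where
    term : (Fin (suc k) × Fin k → Carrier) → Fin (suc k) → Fin k → Carrier
    term G a l = sign a * sign l * G (a , l)
    row : (Fin (suc k) × Fin k → Carrier) → Fin (suc k) → Carrier
    row G a = Σ R k (term G a)

  pairSum-split : ∀ k (H : Fin (suc (suc k)) × Fin (suc k) → Carrier) →
    pairSum (suc k) H ≈ Σ R (suc k) (λ l → sign l * H (zero , l))
                        - Σ R (suc k) (λ a → sign a * H (suc a , zero))
                        + pairSum k (λ (a , l) → H (suc a , suc l))
  pairSum-split k H = begin
    Σ R (suc k) (λ l → 1# * sign l * H (zero , l)) + Σ R (suc k) (λ a → column a + block a)
      ≈⟨ +-cong (Σ-cong (suc k) (λ l → *-congʳ {H (zero , l)} (*-identityˡ (sign l))))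
                (Σ-distrib-+ (suc k) column block) ⟩
    X + (Σ R (suc k) column + Σ R (suc k) block)
      ≈⟨ +-congˡ (+-cong (trans (Σ-cong (suc k) column≈) (sym (-‿distrib-Σ (suc k) Y)))
                         (Σ-cong (suc k) λ a → Σ-cong k λ l → *-congʳ {H (suc a , suc l)} (-sign*-sign a l))) ⟩
    X + (- Σ R (suc k) Y + pairSum k (λ (a , l) → H (suc a , suc l)))
      ≈⟨ +-assoc _ _ _ ⟨
    X - Σ R (suc k) Y + pairSum k (λ (a , l) → H (suc a , suc l)) ∎
    where
    X = Σ R (suc k) (λ l → sign l * H (zero , l))
    Y column block : Fin (suc k) → Carrier
    Y a = sign a * H (suc a , zero)
    column a = - sign a * 1# * H (suc a , zero)
    block a = Σ R k (λ l → - sign a * - sign l * H (suc a , suc l))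
    column≈ : ∀ a → column a ≈ - Y a
    column≈ a = trans (*-congʳ (*-identityʳ _)) (sym (-‿distribˡ-* _ _))
    -sign*-sign : ∀ (a : Fin (suc k)) (l : Fin k) → - sign a * - sign l ≈ sign a * sign l
    -sign*-sign a l = trans (sym (-‿distribˡ-* _ _)) (trans (-‿cong (sym (-‿distribʳ-* _ _))) (-‿involutive _))

  pairSum-symmetric : ∀ k (H : Fin (suc k) × Fin k → Carrier) →
                      (∀ p → H (pairSwap p) ≈ H p) → pairSum k H ≈ 0#
  pairSum-symmetric zero    H sym-H = +-identityʳ 0#
  pairSum-symmetric (suc k) H sym-H = begin
    pairSum (suc k) H
      ≈⟨ pairSum-split k H ⟩
    X - Σ R (suc k) Y + pairSum k (λ (a , l) → H (suc a , suc l))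
      ≈⟨ +-cong (+-congˡ (-‿cong (Σ-cong (suc k) {Y} λ a → *-congˡ {sign a} (sym (sym-H (suc a , zero))))))
                (pairSum-symmetric k _ (λ (a , l) → sym-H (suc a , suc l))) ⟩
    X - X + 0#
      ≈⟨ trans (+-identityʳ _) (-‿inverseʳ X) ⟩
    0# ∎
    where
    X = Σ R (suc k) (λ l → sign l * H (zero , l))
    Y : Fin (suc k) → Carrier
    Y a = sign a * H (suc a , zero)

  pairSum-pairSwap : ∀ k (H : Fin (suc k) × Fin k → Carrier) → pairSum k (H ∘ pairSwap) ≈ - pairSum k H
  pairSum-pairSwap k H = +-inverseˡ-unique _ _ (trans (pairSum-+ k (H ∘ pairSwap) H) (pairSum-symmetric k _ symmetric))
    where
    symmetric : ∀ p → H (pairSwap (pairSwap p)) + H (pairSwap p) ≈ H (pairSwap p) + H p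
    symmetric p = trans (+-congʳ (reflexive (≡.cong H (pairSwap-involutive p)))) (+-comm _ _)

  pairSum-cong : ∀ k {H H′ : Fin (suc k) × Fin k → Carrier} → (∀ p → H p ≈ H′ p) → pairSum k H ≈ pairSum k H′
  pairSum-cong k H≈H′ = Σ-cong (suc k) λ a → Σ-cong k λ l → *-congˡ {sign a * sign l} (H≈H′ (a , l))

  pairTerm : ∀ {m} → Matrix (4 +ℕ m) → Fin (2 +ℕ m) × Fin (suc m) → Carrier
  pairTerm {m} A (j , l) = A zero (suc (suc j)) * A (suc zero) (suc (suc (punchIn j l)))
                         * Pf R m (minor l (minor j (lower (lower A))))

  Pf-expand₂ : ∀ m (A : Matrix (4 +ℕ m)) →
    Pf R _ A ≈ A zero (suc zero) * Pf R (2 +ℕ m) (lower (lower A)) - pairSum (suc m) (pairTerm A)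
  Pf-expand₂ m A = +-cong (*-congʳ (*-identityˡ _)) (begin
    Σ R (2 +ℕ m) (λ j → - sign j * a j * Σ R (suc m) (f j))
      ≈⟨ Σ-cong (2 +ℕ m) row ⟩
    Σ R (2 +ℕ m) (λ j → - Σ R (suc m) (λ l → sign j * sign l * pairTerm A (j , l)))
      ≈⟨ -‿distrib-Σ (2 +ℕ m) (λ j → Σ R (suc m) (λ l → sign j * sign l * pairTerm A (j , l))) ⟨
    - pairSum (suc m) (pairTerm A) ∎)
    where
    a : Fin (2 +ℕ m) → Carrier
    a j = A zero (suc (suc j))
    f : Fin (2 +ℕ m) → Fin (suc m) → Carrier
    f j l = sign l * A (suc zero) (suc (suc (punchIn j l))) * Pf R m (minor l (minor j (lower (lower A))))
    row : ∀ j → - sign j * a j * Σ R (suc m) (f j) ≈ - Σ R (suc m) (λ l → sign j * sign l * pairTerm A (j , l))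
    row j = begin
      - sign j * a j * Σ R (suc m) (f j)      ≈⟨ *-congʳ (-‿distribˡ-* _ _) ⟨
      - (sign j * a j) * Σ R (suc m) (f j)    ≈⟨ -‿distribˡ-* _ _ ⟨
      - (sign j * a j * Σ R (suc m) (f j))    ≈⟨ -‿cong (*-distribˡ-Σ (suc m) _ (f j)) ⟩
      - Σ R (suc m) (λ l → sign j * a j * f j l)
        ≈⟨ -‿cong (Σ-cong (suc m) λ l →
             solve 5 (λ s x t y p → s :* x :* (t :* y :* p) := s :* t :* (x :* y :* p)) refl
               (sign j) (a j) (sign l) (A (suc zero) (suc (suc (punchIn j l))))
               (Pf R m (minor l (minor j (lower (lower A)))))) ⟩
      - Σ R (suc m) (λ l → sign j * sign l * pairTerm A (j , l)) ∎

  swapAt : ∀ {m} → Fin (suc m) → Fin (suc (suc m)) → Fin (suc (suc m))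
  swapAt zero    zero          = suc zero
  swapAt zero    (suc zero)    = zero
  swapAt zero    (suc (suc x)) = suc (suc x)
  swapAt {suc m} (suc k) zero    = zero
  swapAt {suc m} (suc k) (suc x) = suc (swapAt k x)

  swapAt-involutive : ∀ {m} (k : Fin (suc m)) x → swapAt k (swapAt k x) ≡ x
  swapAt-involutive zero    zero          = ≡.refl
  swapAt-involutive zero    (suc zero)    = ≡.refl
  swapAt-involutive zero    (suc (suc x)) = ≡.refl
  swapAt-involutive {suc m} (suc k) zero    = ≡.refl
  swapAt-involutive {suc m} (suc k) (suc x) = ≡.cong suc (swapAt-involutive k x)

  swapAt-inject₁ : ∀ {m} (k : Fin (suc m)) → swapAt k (inject₁ k) ≡ suc k
  swapAt-inject₁ zero            = ≡.refl
  swapAt-inject₁ {suc m} (suc k) = ≡.cong suc (swapAt-inject₁ k)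

  Σ-swapAt : ∀ m (k : Fin (suc m)) (f : Fin (2 +ℕ m) → Carrier) → Σ R (2 +ℕ m) f ≈ Σ R (2 +ℕ m) (f ∘ swapAt k)
  Σ-swapAt m k f = begin
    Σ R (2 +ℕ m) f            ≡⟨ Σ≡sum (2 +ℕ m) f ⟩
    sum f                     ≈⟨ ∑-permute f (permutation (swapAt k) (swapAt k) (swapAt-involutive k) (swapAt-involutive k)) ⟩
    sum (f ∘ swapAt k)        ≡⟨ Σ≡sum (2 +ℕ m) (f ∘ swapAt k) ⟨
    Σ R (2 +ℕ m) (f ∘ swapAt k) ∎

  pairTerm-pairSwap : ∀ {m} (A : Matrix (4 +ℕ m)) p → pairTerm A (pairSwap p) ≈ pairTerm (reindex (swapAt zero) A) p
  pairTerm-pairSwap {m} A (j , l) = begin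
    A zero (suc (suc b)) * A (suc zero) (suc (suc (punchIn b k))) * Pf R m (minor k (minor b (lower (lower A))))
      ≈⟨ *-cong (*-cong (reflexive (≡.cong (λ x → A zero (suc (suc x))) (pairSwap-fst j l)))
                        (reflexive (≡.cong (λ x → A (suc zero) (suc (suc x))) (punchIn-pairSwap j l))))
                (Pf-cong m λ x y → reflexive (≡.cong₂ (λ u v → A (suc (suc u)) (suc (suc v)))
                                                      (punchIn²-pairSwap j l x) (punchIn²-pairSwap j l y))) ⟩
    A zero (suc (suc (punchIn j l))) * A (suc zero) (suc (suc j)) * Pf R m (minor l (minor j (lower (lower A))))
      ≈⟨ *-congʳ (*-comm _ _) ⟩
    pairTerm (reindex (swapAt zero) A) (j , l) ∎
    where
    b = proj₁ (pairSwap (j , l))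
    k = proj₂ (pairSwap (j , l))

  Pf-swap₀₁ : ∀ m (A : Matrix (2 +ℕ m)) → Skew A → Pf R _ (reindex (swapAt zero) A) ≈ - Pf R _ A
  Pf-swap₀₁ zero          A skew =
    trans (Pf₂ (reindex (swapAt zero) A)) (trans (skew (suc zero) zero) (-‿cong (sym (Pf₂ A))))
  Pf-swap₀₁ (suc zero)    A skew =
    trans (Pf₃ (reindex (swapAt zero) A)) (trans (sym -0#≈0#) (-‿cong (sym (Pf₃ A))))
  Pf-swap₀₁ (suc (suc m)) A skew = begin
    Pf R _ (reindex (swapAt zero) A)
      ≈⟨ Pf-expand₂ m (reindex (swapAt zero) A) ⟩
    A (suc zero) zero * Q - pairSum (suc m) (pairTerm (reindex (swapAt zero) A))
      ≈⟨ +-cong (*-congʳ (skew (suc zero) zero))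
                (-‿cong (pairSum-cong (suc m) λ p → sym (pairTerm-pairSwap A p))) ⟩
    - A zero (suc zero) * Q - pairSum (suc m) (pairTerm A ∘ pairSwap)
      ≈⟨ +-cong (sym (-‿distribˡ-* _ _)) (-‿cong (pairSum-pairSwap (suc m) (pairTerm A))) ⟩
    - (A zero (suc zero) * Q) - - pairSum (suc m) (pairTerm A)
      ≈⟨ -‿+-comm _ _ ⟩
    - (A zero (suc zero) * Q - pairSum (suc m) (pairTerm A))
      ≈⟨ -‿cong (Pf-expand₂ m A) ⟨
    - Pf R _ A ∎
    where Q = Pf R (2 +ℕ m) (lower (lower A))

  Pf-equalRows₀₁ : ∀ m (A : Matrix (2 +ℕ m)) → Hollow A → (∀ x → A zero x ≈ A (suc zero) x) → Pf R _ A ≈ 0#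
  Pf-equalRows₀₁ zero          A hollow rows = trans (Pf₂ A) (trans (rows (suc zero)) (hollow (suc zero)))
  Pf-equalRows₀₁ (suc zero)    A hollow rows = Pf₃ A
  Pf-equalRows₀₁ (suc (suc m)) A hollow rows = begin
    Pf R _ A
      ≈⟨ Pf-expand₂ m A ⟩
    A zero (suc zero) * Pf R (2 +ℕ m) (lower (lower A)) - pairSum (suc m) (pairTerm A)
      ≈⟨ +-cong (*-congʳ (trans (rows (suc zero)) (hollow (suc zero))))
                (-‿cong (pairSum-symmetric (suc m) (pairTerm A) symmetric)) ⟩
    0# * Pf R (2 +ℕ m) (lower (lower A)) - 0#
      ≈⟨ +-cong (zeroˡ _) -0#≈0# ⟩
    0# + 0#
      ≈⟨ +-identityʳ 0# ⟩
    0# ∎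
    where
    symmetric : ∀ p → pairTerm A (pairSwap p) ≈ pairTerm A p
    symmetric p = trans (pairTerm-pairSwap A p) (*-congʳ (*-cong (sym (rows _)) (rows _)))

  -- Deleting index swapAt k j from reindex (swapAt k) A leaves minor j A, reindexed by the
  -- identity (and the parity of j flips) if j is one of the swapped pair, by swapAt q otherwise.
  data SwapMinor : ∀ {m} → Fin (suc m) → Fin (2 +ℕ m) → Set (c ⊔ ℓ) where
    swapped : ∀ {m} {k : Fin (suc m)} {j} → sign (swapAt k j) ≈ - sign j →
              (∀ x → swapAt k (punchIn (swapAt k j) x) ≡ punchIn j x) → SwapMinor k j
    kept    : ∀ {m} {k : Fin (2 +ℕ m)} {j} (q : Fin (suc m)) → swapAt k j ≡ j →
              (∀ x → swapAt k (punchIn (swapAt k j) x) ≡ punchIn j (swapAt q x)) → SwapMinor k j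

  swapMinor : ∀ {m} (k : Fin (suc m)) j → SwapMinor k j
  swapMinor zero zero       = swapped refl λ { zero → ≡.refl ; (suc x) → ≡.refl }
  swapMinor zero (suc zero) = swapped (sym (-‿involutive 1#)) λ { zero → ≡.refl ; (suc x) → ≡.refl }
  swapMinor {suc m} zero (suc (suc j)) =
    kept zero ≡.refl λ { zero → ≡.refl ; (suc zero) → ≡.refl ; (suc (suc x)) → ≡.refl }
  swapMinor {suc m} (suc k) zero = kept k ≡.refl λ x → ≡.refl
  swapMinor {suc m} (suc k) (suc j) with swapMinor k j
  ... | swapped sign≈ punchIn≡ = swapped (-‿cong sign≈) λ { zero → ≡.refl ; (suc x) → ≡.cong suc (punchIn≡ x) }
  ... | kept q swap≡ punchIn≡  = kept (suc q) (≡.cong suc swap≡) λ { zero → ≡.refl ; (suc x) → ≡.cong suc (punchIn≡ x) }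

  mutual
    Pf-swapAt : ∀ m (k : Fin (suc m)) (A : Matrix (2 +ℕ m)) → Skew A →
                Pf R _ (reindex (swapAt k) A) ≈ - Pf R _ A
    Pf-swapAt m       zero    A skew = Pf-swap₀₁ m A skew
    Pf-swapAt (suc m) (suc k) A skew = begin
      Σ R (2 +ℕ m) f                ≈⟨ Σ-swapAt m k f ⟩
      Σ R (2 +ℕ m) (f ∘ swapAt k)   ≈⟨ Σ-cong (2 +ℕ m) term ⟩
      Σ R (2 +ℕ m) (λ j → - F j)    ≈⟨ -‿distrib-Σ (2 +ℕ m) F ⟨
      - Σ R (2 +ℕ m) F              ∎
      where
      f F : Fin (2 +ℕ m) → Carrier
      f j = sign j * A zero (suc (swapAt k j)) * Pf R (suc m) (minor j (reindex (swapAt k) (lower A)))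
      F j = sign j * A zero (suc j) * Pf R (suc m) (minor j (lower A))
      term : ∀ j → f (swapAt k j) ≈ - F j
      term j = begin
        sign (swapAt k j) * A zero (suc (swapAt k (swapAt k j))) * P
          ≈⟨ *-congʳ (*-congˡ {sign (swapAt k j)} (reflexive (≡.cong (A zero ∘ suc) (swapAt-involutive k j)))) ⟩
        sign (swapAt k j) * A zero (suc j) * P
          ≈⟨ solve 3 (λ s a p → s :* a :* p := a :* (s :* p)) refl (sign (swapAt k j)) (A zero (suc j)) P ⟩
        A zero (suc j) * (sign (swapAt k j) * P)
          ≈⟨ *-congˡ {A zero (suc j)} (minor-swapAt m k j (lower A) (λ a b → skew (suc a) (suc b))) ⟩
        A zero (suc j) * - (sign j * Pf R (suc m) (minor j (lower A)))
          ≈⟨ -‿distribʳ-* _ _ ⟨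
        - (A zero (suc j) * (sign j * Pf R (suc m) (minor j (lower A))))
          ≈⟨ -‿cong (solve 3 (λ a s p → a :* (s :* p) := s :* a :* p) refl
                       (A zero (suc j)) (sign j) (Pf R (suc m) (minor j (lower A)))) ⟩
        - F j ∎
        where P = Pf R (suc m) (minor (swapAt k j) (reindex (swapAt k) (lower A)))

    minor-swapAt : ∀ m (k : Fin (suc m)) j (B : Matrix (2 +ℕ m)) → Skew B →
      sign (swapAt k j) * Pf R (suc m) (minor (swapAt k j) (reindex (swapAt k) B))
        ≈ - (sign j * Pf R (suc m) (minor j B))
    minor-swapAt m k j B skew with swapMinor k j
    ... | swapped sign≈ punchIn≡ = begin
      sign (swapAt k j) * Pf R (suc m) (minor (swapAt k j) (reindex (swapAt k) B))
        ≈⟨ *-cong sign≈ (Pf-cong (suc m) λ a b → reflexive (≡.cong₂ B (punchIn≡ a) (punchIn≡ b))) ⟩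
      - sign j * Pf R (suc m) (minor j B)
        ≈⟨ -‿distribˡ-* _ _ ⟨
      - (sign j * Pf R (suc m) (minor j B)) ∎
    minor-swapAt (suc m) k j B skew | kept q swap≡ punchIn≡ = begin
      sign (swapAt k j) * Pf R (2 +ℕ m) (minor (swapAt k j) (reindex (swapAt k) B))
        ≈⟨ *-cong (reflexive (≡.cong sign swap≡))
                  (Pf-cong (2 +ℕ m) λ a b → reflexive (≡.cong₂ B (punchIn≡ a) (punchIn≡ b))) ⟩
      sign j * Pf R (2 +ℕ m) (reindex (swapAt q) (minor j B))
        ≈⟨ *-congˡ {sign j} (Pf-swapAt m q (minor j B) (λ a b → skew (punchIn j a) (punchIn j b))) ⟩
      sign j * - Pf R (2 +ℕ m) (minor j B)
        ≈⟨ -‿distribʳ-* _ _ ⟨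
      - (sign j * Pf R (2 +ℕ m) (minor j B)) ∎

  Pf-equalRows : ∀ m (i : Fin (suc m)) (A : Matrix (2 +ℕ m)) → Skew A → Hollow A →
                 (∀ x → A zero x ≈ A (suc i) x) → Pf R _ A ≈ 0#
  Pf-equalRows zero    zero A skew = Pf-equalRows₀₁ zero A
  Pf-equalRows (suc m) i          = <-weakInduction EqualRowsVanish (λ A skew → Pf-equalRows₀₁ (suc m) A) step i
    where
    EqualRowsVanish : Fin (2 +ℕ m) → Set (c ⊔ ℓ)
    EqualRowsVanish i = ∀ (A : Matrix (3 +ℕ m)) → Skew A → Hollow A →
                        (∀ x → A zero x ≈ A (suc i) x) → Pf R _ A ≈ 0#
    step : ∀ i → EqualRowsVanish (inject₁ i) → EqualRowsVanish (suc i)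
    step i vanish A skew hollow rows = begin
      Pf R _ A                               ≈⟨ -‿involutive _ ⟨
      - - Pf R _ A                           ≈⟨ -‿cong (Pf-swapAt (suc m) (suc i) A skew) ⟨
      - Pf R _ (reindex (swapAt (suc i)) A)
        ≈⟨ -‿cong (vanish _ (λ a b → skew (swapAt (suc i) a) (swapAt (suc i) b)) (hollow ∘ swapAt (suc i)) rows′) ⟩
      - 0#                                   ≈⟨ -0#≈0# ⟩
      0#                                     ∎
      where
      rows′ : ∀ x → A zero (swapAt (suc i) x) ≈ A (swapAt (suc i) (suc (inject₁ i))) (swapAt (suc i) x)
      rows′ x = trans (rows _) (reflexive (≡.cong (λ y → A (suc y) (swapAt (suc i) x)) (≡.sym (swapAt-inject₁ i))))

  bordered-skew : ∀ {n} (r : Fin n → Carrier) {M : Matrix n} → Skew M → Skew (bordered r M)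
  bordered-skew r skew zero    zero    = sym -0#≈0#
  bordered-skew r skew zero    (suc b) = sym (-‿involutive (r b))
  bordered-skew r skew (suc a) zero    = refl
  bordered-skew r skew (suc a) (suc b) = skew a b

  bordered-hollow : ∀ {n} (r : Fin n → Carrier) {M : Matrix n} → Hollow M → Hollow (bordered r M)
  bordered-hollow r hollow zero    = refl
  bordered-hollow r hollow (suc a) = hollow a

  Pf-bordered-cong : ∀ n {r r′ : Fin (suc n) → Carrier} {M M′ : Matrix (suc n)} →
    (∀ j → r j ≈ r′ j) → (∀ a b → M a b ≈ M′ a b) → Pf R _ (bordered r M) ≈ Pf R _ (bordered r′ M′)
  Pf-bordered-cong n r≈r′ M≈M′ = Σ-cong (suc n) λ j →
    *-cong (*-congˡ {sign j} (r≈r′ j)) (Pf-cong n λ a b → M≈M′ (punchIn j a) (punchIn j b))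

  Pf-bordered-+ : ∀ n (r r′ : Fin (suc n) → Carrier) (M : Matrix (suc n)) →
    Pf R _ (bordered r M) + Pf R _ (bordered r′ M) ≈ Pf R _ (bordered (λ j → r j + r′ j) M)
  Pf-bordered-+ n r r′ M = trans (sym (Σ-distrib-+ (suc n) (term r) (term r′))) (Σ-cong (suc n) λ j →
    solve 4 (λ s x y p → s :* x :* p :+ s :* y :* p := s :* (x :+ y) :* p) refl
      (sign j) (r j) (r′ j) (Pf R n (minor j M)))
    where
    term : (Fin (suc n) → Carrier) → Fin (suc n) → Carrier
    term ρ j = sign j * ρ j * Pf R n (minor j M)

  -- By linearity in the first row the Pfaffian is - Σᵢ Pf (bordered (M i) M), and each of
  -- these matrices has equal rows zero and suc i.
  Pf-bordered-columnSums : ∀ n (r : Fin (suc n) → Carrier) (M : Matrix (suc n)) → Skew M → Hollow M →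
    (∀ j → r j ≈ - Σ R (suc n) (λ i → M i j)) → Pf R _ (bordered r M) ≈ 0#
  Pf-bordered-columnSums n r M skew hollow r≈ = begin
    Σ R (suc n) (λ j → sign j * r j * P j)
      ≈⟨ Σ-cong (suc n) term ⟩
    Σ R (suc n) (λ j → - Σ R (suc n) (λ i → sign j * M i j * P j))
      ≈⟨ -‿distrib-Σ (suc n) (λ j → Σ R (suc n) (λ i → sign j * M i j * P j)) ⟨
    - Σ R (suc n) (λ j → Σ R (suc n) (λ i → sign j * M i j * P j))
      ≈⟨ -‿cong (Σ-comm (suc n) (suc n) λ j i → sign j * M i j * P j) ⟩
    - Σ R (suc n) (λ i → Pf R _ (bordered (M i) M))
      ≈⟨ -‿cong (Σ-zero (suc n) λ i →
           Pf-equalRows n i (bordered (M i) M) (bordered-skew (M i) skew) (bordered-hollow (M i) hollow) (rows i)) ⟩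
    - 0#
      ≈⟨ -0#≈0# ⟩
    0# ∎
    where
    P : Fin (suc n) → Carrier
    P j = Pf R n (minor j M)
    term : ∀ j → sign j * r j * P j ≈ - Σ R (suc n) (λ i → sign j * M i j * P j)
    term j = begin
      sign j * r j * P j                                ≈⟨ *-congʳ (*-congˡ {sign j} (r≈ j)) ⟩
      sign j * - Σ R (suc n) (λ i → M i j) * P j        ≈⟨ *-congʳ (-‿distribʳ-* _ _) ⟨
      - (sign j * Σ R (suc n) (λ i → M i j)) * P j      ≈⟨ -‿distribˡ-* _ _ ⟨
      - (sign j * Σ R (suc n) (λ i → M i j) * P j)
        ≈⟨ -‿cong (trans (*-congʳ (*-distribˡ-Σ (suc n) (sign j) (λ i → M i j)))
                         (*-distribʳ-Σ (suc n) (P j) (λ i → sign j * M i j))) ⟩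
      - Σ R (suc n) (λ i → sign j * M i j * P j)         ∎
    rows : ∀ i x → bordered (M i) M zero x ≈ bordered (M i) M (suc i) x
    rows i zero    = sym (trans (-‿cong (hollow i)) -0#≈0#)
    rows i (suc x) = refl

  -- Alternating trilinear forms on basis vectors

  basis : ∀ {D} → Fin D → Vect R D
  basis P = v R (suc (toℕ P))

  v≗basis-fromℕ< : ∀ {D p} (p<D : p < D) → v R (suc p) ≗ basis (fromℕ< p<D)
  v≗basis-fromℕ< p<D b = ≡.cong (λ q → v R (suc q) b) (≡.sym (toℕ-fromℕ< p<D))

  Σ-basis : ∀ {D} {u : Vect R D} {P} → u ≗ basis P → (f : Fin D → Carrier) → Σ R D (λ b → u b * f b) ≈ f P
  Σ-basis {D} {u} {P} u≗ f = trans (Σ-cong D λ b → *-congʳ (reflexive (u≗ b))) (Σ-basis′ P f)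
    where
    Σ-basis′ : ∀ {D} (P : Fin D) (f : Fin D → Carrier) → Σ R D (λ b → basis P b * f b) ≈ f P
    Σ-basis′ {suc D} zero    f = trans (+-cong (*-identityˡ _) (Σ-zero D λ b → zeroˡ (f (suc b)))) (+-identityʳ _)
    Σ-basis′ {suc D} (suc P) f = trans (+-cong (zeroˡ _) (Σ-basis′ P (f ∘ suc))) (+-identityˡ _)

  module _ {D} (t : Fin D → Fin D → Fin D → Carrier) where

    wedge3-basis : ∀ {u₁ u₂ u₃ P Q T} → u₁ ≗ basis P → u₂ ≗ basis Q → u₃ ≗ basis T →
                   wedge3 R t u₁ u₂ u₃ ≈ t P Q T
    wedge3-basis {u₁} {u₂} {u₃} {P} {Q} {T} u₁≗ u₂≗ u₃≗ = begin
      Σ R D (λ a → Σ R D (λ b → Σ R D (λ d → u₁ a * u₂ b * u₃ d * t a b d)))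
        ≈⟨ Σ-cong D (λ a → Σ-cong D λ b → trans (Σ-cong D λ d →
             solve 4 (λ x y z w → x :* y :* z :* w := z :* (x :* y :* w)) refl (u₁ a) (u₂ b) (u₃ d) (t a b d))
             (Σ-basis u₃≗ _)) ⟩
      Σ R D (λ a → Σ R D (λ b → u₁ a * u₂ b * t a b T))
        ≈⟨ Σ-cong D (λ a → trans (Σ-cong D λ b →
             solve 3 (λ x y w → x :* y :* w := y :* (x :* w)) refl (u₁ a) (u₂ b) (t a b T))
             (Σ-basis u₂≗ _)) ⟩
      Σ R D (λ a → u₁ a * t a Q T)
        ≈⟨ Σ-basis u₁≗ _ ⟩
      t P Q T ∎

    wedge3-⊕ : ∀ u₁ u₂ x y → wedge3 R t u₁ u₂ (_⊕_ R x y) ≈ wedge3 R t u₁ u₂ x + wedge3 R t u₁ u₂ y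
    wedge3-⊕ u₁ u₂ x y = begin
      Σ R D (λ a → Σ R D (λ b → Σ R D (λ d → u₁ a * u₂ b * (x d + y d) * t a b d)))
        ≈⟨ Σ-cong D (λ a → Σ-cong D λ b → trans (Σ-cong D λ d →
             solve 5 (λ p q r s w → p :* q :* (r :+ s) :* w := p :* q :* r :* w :+ p :* q :* s :* w) refl
               (u₁ a) (u₂ b) (x d) (y d) (t a b d))
             (Σ-distrib-+ D (term x a b) (term y a b))) ⟩
      Σ R D (λ a → Σ R D (λ b → Σ R D (term x a b) + Σ R D (term y a b)))
        ≈⟨ Σ-cong D (λ a → Σ-distrib-+ D (λ b → Σ R D (term x a b)) (λ b → Σ R D (term y a b))) ⟩
      Σ R D (λ a → Σ R D (λ b → Σ R D (term x a b)) + Σ R D (λ b → Σ R D (term y a b)))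
        ≈⟨ Σ-distrib-+ D _ _ ⟩
      wedge3 R t u₁ u₂ x + wedge3 R t u₁ u₂ y ∎
      where
      term : Vect R D → Fin D → Fin D → Fin D → Carrier
      term z a b d = u₁ a * u₂ b * z d * t a b d

    -- Λbasis e x₁ x₂ y a b is λᵢⱼ = Σₖ yᵢⱼₖ, evaluated under t, for the family
    -- (basis x₁ ⊕ basis x₂, basis y, basis (e 0), basis (e 1), …) with wᵢ = basis a, wⱼ = basis b.
    Λbasis : ∀ {n} → (Fin n → Fin D) → (x₁ x₂ y : Fin D) → Matrix D
    Λbasis {n} e x₁ x₂ y a b = (t a b x₁ + t a b x₂) + (t a b y + Σ R n (λ k → t a b (e k)))

    treeMatrix : ∀ {n} → (Fin n → Fin D) → (x₁ x₂ y : Fin D) → Matrix (suc n)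
    treeMatrix e x₁ x₂ y = reindex (y ∷ e) (Λbasis e x₁ x₂ y)

    evalP-fam : ∀ n (e : Fin n → Fin D) {x₁ x₂ y : Vect R D} {X₁ X₂ Y} →
      x₁ ≗ basis X₁ → x₂ ≗ basis X₂ → y ≗ basis Y → (∀ k → v R (toℕ k +ℕ 5) ≗ basis (e k)) →
      evalP R (suc n) t (fam R n (_⊕_ R x₁ x₂) y) ≈ Pf R (suc n) (treeMatrix e X₁ X₂ Y)
    evalP-fam n e {x₁} {x₂} {y} {Y = Y} x₁≗ x₂≗ y≗ e≗ = Pf-cong (suc n) λ i j →
      +-cong (trans (wedge3-⊕ (w (suc i)) (w (suc j)) x₁ x₂)
                    (+-cong (wedge3-basis (w≗ i) (w≗ j) x₁≗) (wedge3-basis (w≗ i) (w≗ j) x₂≗)))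
             (+-cong (wedge3-basis (w≗ i) (w≗ j) y≗) (Σ-cong n λ k → wedge3-basis (w≗ i) (w≗ j) (e≗ k)))
      where
      w : Fin (2 +ℕ n) → Vect R D
      w = fam R n (_⊕_ R x₁ x₂) y
      w≗ : ∀ i → w (suc i) ≗ basis ((Y ∷ e) i)
      w≗ zero    = y≗
      w≗ (suc k) = e≗ k

    Λbasis-rotate : ∀ {n} (e : Fin n → Fin D) x₁ x₂ y a b → Λbasis e x₂ y x₁ a b ≈ Λbasis e x₁ x₂ y a b
    Λbasis-rotate e x₁ x₂ y a b = solve 4 (λ p q r s → (q :+ r) :+ (p :+ s) := (p :+ q) :+ (r :+ s)) refl _ _ _ _

    Λbasis-swap : ∀ {n} (e : Fin n → Fin D) x₁ x₂ y a b → Λbasis e x₁ y x₂ a b ≈ Λbasis e x₁ x₂ y a b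
    Λbasis-swap e x₁ x₂ y a b = solve 4 (λ p q r s → (p :+ r) :+ (q :+ s) := (p :+ q) :+ (r :+ s)) refl _ _ _ _

    module _ (alt : IsAlternating R t) where

      t-antisym : ∀ a b d → t a b d ≈ - t b a d
      t-antisym = proj₁ alt

      t-antisym₁₃ : ∀ a b d → t a b d ≈ - t d b a
      t-antisym₁₃ a b d = begin
        t a b d      ≈⟨ proj₁ (proj₂ alt) a b d ⟩
        t b d a      ≈⟨ -‿involutive _ ⟨
        - - t b d a  ≈⟨ -‿cong (t-antisym d b a) ⟨
        - t d b a    ∎

      t-diag₁₃ : ∀ a b → t a b a ≈ 0#
      t-diag₁₃ a b = trans (proj₁ (proj₂ alt) a b a) (trans (proj₁ (proj₂ alt) b a a) (proj₂ (proj₂ alt) a b))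

      Λbasis-skew : ∀ {n} (e : Fin n → Fin D) x₁ x₂ y → Skew (Λbasis e x₁ x₂ y)
      Λbasis-skew {n} e x₁ x₂ y a b = begin
        (t a b x₁ + t a b x₂) + (t a b y + Σ R n (λ k → t a b (e k)))
          ≈⟨ +-cong (+-cong (t-antisym a b x₁) (t-antisym a b x₂))
                    (+-cong (t-antisym a b y) (trans (Σ-cong n λ k → t-antisym a b (e k))
                                                     (sym (-‿distrib-Σ n (λ k → t b a (e k)))))) ⟩
        (- t b a x₁ + - t b a x₂) + (- t b a y + - Σ R n (λ k → t b a (e k)))
          ≈⟨ +-cong (-‿+-comm _ _) (-‿+-comm _ _) ⟩
        - (t b a x₁ + t b a x₂) + - (t b a y + Σ R n (λ k → t b a (e k)))
          ≈⟨ -‿+-comm _ _ ⟩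
        - Λbasis e x₁ x₂ y b a ∎

      Λbasis-hollow : ∀ {n} (e : Fin n → Fin D) x₁ x₂ y → Hollow (Λbasis e x₁ x₂ y)
      Λbasis-hollow {n} e x₁ x₂ y a = begin
        (t a a x₁ + t a a x₂) + (t a a y + Σ R n (λ k → t a a (e k)))
          ≈⟨ +-cong (+-cong (diag x₁) (diag x₂)) (+-cong (diag y) (Σ-zero n λ k → diag (e k))) ⟩
        (0# + 0#) + (0# + 0#)
          ≈⟨ solve 0 (((con 0 :+ con 0) :+ (con 0 :+ con 0)) := con 0) refl ⟩
        0# ∎
        where
        diag : ∀ d → t a a d ≈ 0#
        diag = proj₂ (proj₂ alt) a

      module _ {n} (e : Fin n → Fin D) (E : Fin D) where

        κ : Fin D → Carrier
        κ z = Σ R n (λ k → t z E (e k))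

        Λbasis-border-sum : ∀ a b c →
          Λbasis e a b c c E + Λbasis e b c a a E + Λbasis e a c b b E ≈ (κ a + κ b) + κ c
        Λbasis-border-sum a b c = begin
          ((t c E a + t c E b) + (t c E c + κ c)) + ((t a E b + t a E c) + (t a E a + κ a))
            + ((t b E a + t b E c) + (t b E b + κ b))
            ≈⟨ +-cong (+-cong (+-cong (+-cong (t-antisym₁₃ c E a) (t-antisym₁₃ c E b)) (+-congʳ (t-diag₁₃ c E)))
                              (+-congˡ (+-congʳ (t-diag₁₃ a E))))
                      (+-cong (+-congʳ (t-antisym₁₃ b E a)) (+-congʳ (t-diag₁₃ b E))) ⟩
          ((- A + - B) + (0# + κ c)) + ((C + A) + (0# + κ a)) + ((- C + B) + (0# + κ b))
            ≈⟨ solve 9 (λ a b c na nb nc x y z →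
                 ((na :+ nb) :+ (con 0 :+ z)) :+ ((c :+ a) :+ (con 0 :+ x)) :+ ((nc :+ b) :+ (con 0 :+ y))
                 := ((a :+ na) :+ ((b :+ nb) :+ (c :+ nc))) :+ ((x :+ y) :+ z))
                 refl A B C (- A) (- B) (- C) (κ a) (κ b) (κ c) ⟩
          ((A - A) + ((B - B) + (C - C))) + ((κ a + κ b) + κ c)
            ≈⟨ +-congʳ (+-cong (-‿inverseʳ A) (+-cong (-‿inverseʳ B) (-‿inverseʳ C))) ⟩
          (0# + (0# + 0#)) + ((κ a + κ b) + κ c)
            ≈⟨ trans (+-congʳ (trans (+-identityˡ _) (+-identityˡ _))) (+-identityˡ _) ⟩
          (κ a + κ b) + κ c ∎
          where
          A = t a E c
          B = t b E c
          C = t a E b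

        Λbasis-column-sum : ∀ a b c → Σ R n (λ i → Λbasis e a b c (e i) E) ≈ - ((κ a + κ b) + κ c)
        Λbasis-column-sum a b c = begin
          Σ R n (λ i → (t (e i) E a + t (e i) E b) + (t (e i) E c + κ (e i)))
            ≈⟨ Σ-distrib-+ n _ _ ⟩
          Σ R n (λ i → t (e i) E a + t (e i) E b) + Σ R n (λ i → t (e i) E c + κ (e i))
            ≈⟨ +-cong (Σ-distrib-+ n _ _) (Σ-distrib-+ n _ _) ⟩
          (Σ R n (column a) + Σ R n (column b)) + (Σ R n (column c) + Σ R n κ′)
            ≈⟨ +-cong (+-cong (Σ-column a) (Σ-column b))
                      (+-cong (Σ-column c) (Σ-skew n (λ i k → t (e i) E (e k))
                                                     (λ i k → t-antisym₁₃ (e i) E (e k)) (λ i → t-diag₁₃ (e i) E))) ⟩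
          (- κ a + - κ b) + (- κ c + 0#)
            ≈⟨ +-cong (-‿+-comm _ _) (+-identityʳ _) ⟩
          - (κ a + κ b) + - κ c
            ≈⟨ -‿+-comm _ _ ⟩
          - ((κ a + κ b) + κ c) ∎
          where
          column : Fin D → Fin n → Carrier
          column z i = t (e i) E z
          κ′ : Fin n → Carrier
          κ′ i = κ (e i)
          Σ-column : ∀ z → Σ R n (column z) ≈ - κ z
          Σ-column z = trans (Σ-cong n λ i → t-antisym₁₃ (e i) E z) (sym (-‿distrib-Σ n λ k → t z E (e k)))

      Pf-treeMatrix-sum : ∀ n (e : Fin n → Fin D) a b c →
        Pf R (suc n) (treeMatrix e a b c) + Pf R (suc n) (treeMatrix e b c a) + Pf R (suc n) (treeMatrix e a c b) ≈ 0#
      Pf-treeMatrix-sum zero    e a b c = trans (+-identityʳ _) (+-identityʳ 0#)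
      Pf-treeMatrix-sum (suc n) e a b c = begin
        Pf R _ (bordered (border a b c) M) + Pf R _ (bordered (border b c a) (reindex e (Λbasis e b c a)))
          + Pf R _ (bordered (border a c b) (reindex e (Λbasis e a c b)))
          ≈⟨ +-cong (+-congˡ (Pf-bordered-cong n {border b c a} (λ j → refl) λ i j → Λbasis-rotate e a b c (e i) (e j)))
                    (Pf-bordered-cong n {border a c b} (λ j → refl) λ i j → Λbasis-swap e a b c (e i) (e j)) ⟩
        Pf R _ (bordered (border a b c) M) + Pf R _ (bordered (border b c a) M) + Pf R _ (bordered (border a c b) M)
          ≈⟨ trans (+-congʳ (Pf-bordered-+ n (border a b c) (border b c a) M))
                   (Pf-bordered-+ n (λ j → border a b c j + border b c a j) (border a c b) M) ⟩
        Pf R _ (bordered (λ j → border a b c j + border b c a j + border a c b j) M)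
          ≈⟨ Pf-bordered-columnSums n _ M (λ i j → Λbasis-skew e a b c (e i) (e j))
                                         (λ i → Λbasis-hollow e a b c (e i)) border-sum ⟩
        0# ∎
        where
        M : Matrix (suc n)
        M = reindex e (Λbasis e a b c)
        border : Fin D → Fin D → Fin D → Fin (suc n) → Carrier
        border x₁ x₂ y j = Λbasis e x₁ x₂ y y (e j)
        border-sum : ∀ j → border a b c j + border b c a j + border a c b j ≈ - Σ R (suc n) (λ i → M i j)
        border-sum j = trans (Λbasis-border-sum e (e j) a b c)
                             (sym (trans (-‿cong (Λbasis-column-sum e (e j) a b c)) (-‿involutive _)))

proposition6p4 : ∀ {c ℓ} (R : CommutativeRing c ℓ) (n : ℕ)
    → let open CommutativeRing R
          m = suc (suc n)
      in (t : Fin (m +ℕ 2) → Fin (m +ℕ 2) → Fin (m +ℕ 2) → Carrier)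
    → IsAlternating R t
    → evalP R (suc n) t (fam R n (_⊕_ R (v R 2) (v R 3)) (v R 4))
      + evalP R (suc n) t (fam R n (_⊕_ R (v R 3) (v R 4)) (v R 2))
      + evalP R (suc n) t (fam R n (_⊕_ R (v R 2) (v R 4)) (v R 3))
      ≈ 0#
proposition6p4 R n t alt =
  trans (+-cong (+-cong (evalP-fam R t n e (v≗ 1<) (v≗ 2<) (v≗ 3<) e≗)
                        (evalP-fam R t n e (v≗ 2<) (v≗ 3<) (v≗ 1<) e≗))
                (evalP-fam R t n e (v≗ 1<) (v≗ 3<) (v≗ 2<) e≗))
        (Pf-treeMatrix-sum R t alt n e (index 1<) (index 2<) (index 3<))
  where
  open CommutativeRing R using (trans; +-cong)
  1< : 1 < 4 +ℕ n
  1< = s≤s (s≤s z≤n)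
  2< : 2 < 4 +ℕ n
  2< = s≤s (s≤s (s≤s z≤n))
  3< : 3 < 4 +ℕ n
  3< = s≤s (s≤s (s≤s (s≤s z≤n)))
  within : ∀ {p} → p < 4 +ℕ n → p < suc (suc n) +ℕ 2
  within {p} = ≡.subst (p <_) (≡.cong (λ k → suc (suc k)) (ℕ.+-comm 2 n))
  index : ∀ {p} → p < 4 +ℕ n → Fin (suc (suc n) +ℕ 2)
  index p< = fromℕ< (within p<)
  v≗ : ∀ {p} (p< : p < 4 +ℕ n) → v R (suc p) ≗ basis R (index p<)
  v≗ p< = v≗basis-fromℕ< R (within p<)
  e : Fin n → Fin (suc (suc n) +ℕ 2)
  e k = index (ℕ.+-monoʳ-< 4 (toℕ<n k))
  e≗ : ∀ k → v R (toℕ k +ℕ 5) ≗ basis R (e k)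
  e≗ k b = ≡.trans (≡.cong (λ q → v R q b) (ℕ.+-comm (toℕ k) 5)) (v≗ (ℕ.+-monoʳ-< 4 (toℕ<n k)) b)
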